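{- Let $a,b,k$ be nonnegative integers with $0\le k\le b$, and let $\mu_1,\mu_2\in\mathsf{T}_{\delta(k)}(a,b)$ have simplified triples $(a-s_1,u_1,v_1)$ and $(a-s_2,u_2,v_2)$. Then $\mu_1\le\mu_2$ in $\mathsf{T}_{\delta(k)}(a,b)$ if and only if $s_1\ge s_2$, $u_1\le u_2$, and $v_1\le v_2$.
   Context: A lattice path is a finite word in $N$ (unit north step) and $E$ (unit east step), drawn from the origin; exponents denote repetition. For $\nu=E^{\nu_0}NE^{\nu_1}N\cdots NE^{\nu_n}$, a $\nu$-path is a lattice path with the same endpoints as $\nu$ that stays weakly above $\nu$. An increment vector is an integer vector $\delta=(\delta_1,\dots,\delta_n)$ with $0\le\delta_i\le\nu_i$. The $\delta$-altitude along a $\nu$-path is $0$ at the start, decreases by $1$ after each $E$ step, and increases by $\delta_i$ after the $i$th $N$ step. A $\delta$-rotation at a valley $EN$ is defined as follows. Let $x$ be the point between the $E$ and $N$, and let $y$ be the first later point with the same $\delta$-altitude. Interchange the subpath from $x$ to $y$ with the $E$ step preceding $x$. The alt $\nu$-Tamari lattice $\mathrm{Tam}_\delta(\nu)$ is the poset on $\nu$-paths whose cover relations are the $\delta$-rotations. Here $\nu=E^aNE^bN$, so $(\nu_0,\nu_1,\nu_2)=(a,b,0)$ and the increment vectors are $\delta(k)=(k,0)$ with $0\le k\le b$. Write $\mathsf{T}_{\delta(k)}(a,b)=\mathrm{Tam}_{\delta(k)}(\nu)$, and let $\widehat\nu(k)=E^{a+b-k}NE^kN$. Bracket vectors: for a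 lattice path $\rho$ from $(0,0)$ to $(r-n,n)$, let $\mathbf a(\rho)$ list the $y$-coordinates of its lattice points. The fixed positions are $f_i=\max\{j:a_j=i\}$. For a $\rho$-path $\mu$, its bracket vector $\mathbf b(\mu)$ is built as follows: set $b_{f_i}=i$; then for $i=0,\dots,n$ in turn, assign $i$ to the first $g_i-1$ unassigned positions to the left of $f_i$, scanning right to left, where $g_i$ is the number of entries $i$ in $\mathbf a(\mu)$. Each $\mu\in\mathsf{T}_{\delta(k)}(a,b)$ has $\widehat\nu(k)$-bracket vector of the form $(\alpha,0^{s},\underline0,\beta,\underline1,\underline2)$. Here the underlined entries are fixed, $\alpha$ has $a+b-k-s$ entries, $\beta$ has $k$ entries, and $(\alpha,\beta)$ consists of $2$'s followed by $1$'s. The simplified triple of $\mu$ is $(a-s,u,v)$, where $u$ is the number of $2$'s in $\alpha$ and $v$ is the number of $2$'s in $\beta$. -}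

module Defs where

open import Data.Nat using (ℕ; zero; suc; _+_; _∸_; _≤_; _<_)
open import Data.Nat.Properties using (_≟_)
open import Data.Integer as ℤ using (ℤ; +_; -[1+_])
open import Data.List using (List; []; _∷_; _++_; take; drop; reverse; length; replicate; foldl; upTo; filter)
open import Data.Maybe using (Maybe; just; nothing)
open import Data.Product using (_×_; _,_; ∃; Σ)
open import Relation.Binary.PropositionalEquality using (_≡_; _≢_)
open import Relation.Binary.Construct.Closure.ReflexiveTransitive using (Star)
open import Relation.Nullary using (yes; no)

data Step : Set where
  N E : Step

Path : Set
Path = List Step

Es : ℕ → Path
Es m = replicate m E

countN : Path → ℕ
countN [] = 0
countN (N ∷ w) = suc (countN w)
countN (E ∷ w) = countN w

countE : Path → ℕ
countE [] = 0
countE (N ∷ w) = countE w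
countE (E ∷ w) = suc (countE w)

-- μ is a ν-path: same endpoints as ν and weakly above ν
-- (every prefix of μ has at least as many N steps as the prefix of ν of
-- the same length).
IsNuPath : Path → Path → Set
IsNuPath ν μ = (countN μ ≡ countN ν) × (countE μ ≡ countE ν)
             × (∀ t → countN (take t ν) ≤ countN (take t μ))

-- δ-altitude.  δ is given as the list (δ₁ , … , δₙ).

δat : List ℕ → ℕ → ℕ      -- δat δ i = δ_{i+1}  (0 outside range)
δat [] i = 0
δat (d ∷ δ) zero = d
δat (d ∷ δ) (suc i) = δat δ i

-- change of δ-altitude along a word w, given that i north steps
-- have already been taken before w
altChange : List ℕ → ℕ → Path → ℤ
altChange δ i [] = + 0
altChange δ i (E ∷ w) = -[1+ 0 ] ℤ.+ altChange δ i w
altChange δ i (N ∷ w) = + (δat δ i) ℤ.+ altChange δ (suc i) w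

-- δ-rotation at a valley E N:
--   μ = P E (N R),  x = point after P E, the valley N is the
--   (countN P + 1)-th north step.  N R = S T where S is the subpath from
--   x to y (y = first later point with the same δ-altitude as x).
Rotation : List ℕ → Path → Path → Set
Rotation δ μ μ' =
  Σ Path λ P → Σ Path λ R → Σ Path λ S → Σ Path λ T →
    (μ ≡ P ++ E ∷ N ∷ R) × (N ∷ R ≡ S ++ T) ×
    (0 < length S) ×
    (altChange δ (countN P) S ≡ + 0) ×
    (∀ j → 0 < j → j < length S → altChange δ (countN P) (take j S) ≢ + 0) ×
    (μ' ≡ P ++ S ++ E ∷ T)

Cover : Path → List ℕ → Path → Path → Set
Cover ν δ μ μ' = IsNuPath ν μ × IsNuPath ν μ' × Rotation δ μ μ'

_≤[_,_]_ : Path → Path → List ℕ → Path → Set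
μ ≤[ ν , δ ] μ' = Star (Cover ν δ) μ μ'

νab : ℕ → ℕ → Path
νab a b = Es a ++ N ∷ Es b ++ N ∷ []

δk : ℕ → List ℕ
δk k = k ∷ 0 ∷ []

νhat : ℕ → ℕ → ℕ → Path
νhat a b k = Es (a + b ∸ k) ++ N ∷ Es k ++ N ∷ []

TamLeq : ℕ → ℕ → ℕ → Path → Path → Set
TamLeq a b k μ μ' = μ ≤[ νab a b , δk k ] μ'

ysFrom : ℕ → Path → List ℕ
ysFrom y [] = y ∷ []
ysFrom y (E ∷ w) = y ∷ ysFrom y w
ysFrom y (N ∷ w) = y ∷ ysFrom (suc y) w

ys : Path → List ℕ
ys = ysFrom 0

countEq : ℕ → List ℕ → ℕ
countEq i [] = 0
countEq i (x ∷ xs) with x ≟ i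
... | yes _ = suc (countEq i xs)
... | no _ = countEq i xs

-- last index j with xs_j = i (0 if none)
lastIdxFrom : ℕ → ℕ → ℕ → List ℕ → ℕ
lastIdxFrom i pos acc [] = acc
lastIdxFrom i pos acc (x ∷ xs) with x ≟ i
... | yes _ = lastIdxFrom i (suc pos) pos xs
... | no _ = lastIdxFrom i (suc pos) acc xs

fixedPos : Path → ℕ → ℕ
fixedPos ρ i = lastIdxFrom i 0 0 (ys ρ)

setAt : ℕ → ℕ → List (Maybe ℕ) → List (Maybe ℕ)
setAt j v [] = []
setAt zero v (_ ∷ xs) = just v ∷ xs
setAt (suc j) v (x ∷ xs) = x ∷ setAt j v xs

fillScan : ℕ → ℕ → List (Maybe ℕ) → List (Maybe ℕ)
fillScan i zero xs = xs
fillScan i (suc c) [] = []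
fillScan i (suc c) (nothing ∷ xs) = just i ∷ fillScan i c xs
fillScan i (suc c) (just x ∷ xs) = just x ∷ fillScan i (suc c) xs

fillLeft : ℕ → ℕ → ℕ → List (Maybe ℕ) → List (Maybe ℕ)
fillLeft i c f b = reverse (fillScan i c (reverse (take f b))) ++ drop f b

bracket : Path → Path → List (Maybe ℕ)
bracket ρ μ =
  foldl (λ b i → fillLeft i (countEq i (ys μ) ∸ 1) (fixedPos ρ i) b)
        (foldl (λ b i → setAt (fixedPos ρ i) i b)
               (replicate (suc (length ρ)) nothing) is)
        is
  where
  is = upTo (suc (countN ρ))

countJust : ℕ → List (Maybe ℕ) → ℕ
countJust i [] = 0
countJust i (nothing ∷ xs) = countJust i xs
countJust i (just x ∷ xs) with x ≟ i
... | yes _ = suc (countJust i xs)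
... | no _ = countJust i xs

-- Simplified triple (a - s, u, v) read off the ν̂(k)-bracket vector
-- (α, 0^s, 0̲, β, 1̲, 2̲) of μ.

bvec : ℕ → ℕ → ℕ → Path → List (Maybe ℕ)
bvec a b k μ = bracket (νhat a b k) μ

-- s : number of non-fixed 0 entries (α, β contain no 0)
sOf : ℕ → ℕ → ℕ → Path → ℕ
sOf a b k μ = countJust 0 (bvec a b k μ) ∸ 1

-- u : number of 2's in α (the part left of the fixed 0)
uOf : ℕ → ℕ → ℕ → Path → ℕ
uOf a b k μ = countJust 2 (take (fixedPos (νhat a b k) 0) (bvec a b k μ))

-- v : number of 2's in β (strictly between the fixed 0 and fixed 1)
vOf : ℕ → ℕ → ℕ → Path → ℕ
vOf a b k μ = countJust 2 (drop (suc f0) (take f1 (bvec a b k μ)))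
  where
  f0 = fixedPos (νhat a b k) 0
  f1 = fixedPos (νhat a b k) 1

simplifiedTriple : ℕ → ℕ → ℕ → Path → ℕ × ℕ × ℕ
simplifiedTriple a b k μ = (a ∸ sOf a b k μ , uOf a b k μ , vOf a b k μ)

-- A ν-path is E^p N E^q N E^r with p ≤ a and p + q + r = a + b.  Filling the ν̂(k)-bracket
-- vector gives (2^u 1^(q ∸ k) 0^p, 0̲, 2^v 1^(q ⊓ k), 1̲, 2̲) with v = k ∸ q and u = r ∸ v, so
-- s = p and u + v = r.  A δ(k)-rotation either moves the second N one step left, or lowers p,
-- the displaced E joining the middle run when k ≤ q and the last run when q < k; each move is
-- monotone for (−s, u, v).  Conversely, from a smaller triple one lowers p by rotations at the
-- first valley, which keep u and v below their targets, and then, p being equal, u + v = r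
-- shows that the target is reached by rotations at the second valley.
module Submission where

open import Data.Empty using (⊥-elim)
import Data.Integer as ℤ
import Data.Integer.Properties as ℤₚ
open import Data.List using (List; []; _∷_; _++_; _∷ʳ_; take; drop; reverse; length; replicate; map)
open import Data.List.Properties
  using (++-assoc; map-replicate; length-++; length-replicate;
         reverse-++; reverse-involutive; reverse-map; unfold-reverse; ∷-injective)
open import Data.Maybe using (Maybe; just; nothing; _<∣>_)
open import Data.Nat using (ℕ; zero; suc; _+_; _∸_; _⊓_; _≤_; _≰_; _<_; _≥_; z≤n; s≤s)
open import Data.Nat.Properties
open import Data.Nat.Tactic.RingSolver using (solve-∀)
open import Data.Product using (_×_; _,_; Σ-syntax; proj₂)
open import Data.Sum using (_⊎_; inj₁; inj₂; swap)
open import Function.Base using (_∘_)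
open import Function.Bundles using (_⇔_; mk⇔; Equivalence)
open import Relation.Binary.Construct.Closure.ReflexiveTransitive using (Star; ε; _◅_)
open import Relation.Binary.PropositionalEquality
open import Relation.Nullary using (yes; no)

open import Defs

replicate-+ : ∀ {A : Set} m n (x : A) → replicate (m + n) x ≡ replicate m x ++ replicate n x
replicate-+ zero    n x = refl
replicate-+ (suc m) n x = cong (x ∷_) (replicate-+ m n x)

replicate-++-∷ : ∀ {A : Set} n (x : A) ys → replicate n x ++ x ∷ ys ≡ x ∷ replicate n x ++ ys
replicate-++-∷ zero    x ys = refl
replicate-++-∷ (suc n) x ys = cong (x ∷_) (replicate-++-∷ n x ys)

take-length-++ : ∀ {A : Set} (xs ys : List A) → take (length xs) (xs ++ ys) ≡ xs
take-length-++ []       ys = refl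
take-length-++ (x ∷ xs) ys = cong (x ∷_) (take-length-++ xs ys)

drop-length-++ : ∀ {A : Set} (xs ys : List A) → drop (length xs) (xs ++ ys) ≡ ys
drop-length-++ []       ys = refl
drop-length-++ (x ∷ xs) ys = drop-length-++ xs ys

drop-suc-length-++ : ∀ {A : Set} (xs : List A) y ys → drop (suc (length xs)) (xs ++ y ∷ ys) ≡ ys
drop-suc-length-++ []       y ys = refl
drop-suc-length-++ (x ∷ xs) y ys = drop-suc-length-++ xs y ys

++-∷-++-∷-∷ : ∀ {A : Set} xs (x : A) ys y z → xs ++ x ∷ ys ++ y ∷ z ∷ [] ≡ ((xs ++ x ∷ ys) ++ y ∷ []) ++ z ∷ []
++-∷-++-∷-∷ xs x ys y z = begin
  xs ++ x ∷ ys ++ y ∷ z ∷ []          ≡⟨ ++-assoc xs (x ∷ ys) (y ∷ z ∷ []) ⟨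
  (xs ++ x ∷ ys) ++ y ∷ z ∷ []        ≡⟨ ++-assoc (xs ++ x ∷ ys) (y ∷ []) (z ∷ []) ⟨
  ((xs ++ x ∷ ys) ++ y ∷ []) ++ z ∷ [] ∎
  where open ≡-Reasoning

length-replicate₂ : ∀ {A : Set} m n (x y : A) → length (replicate m x ++ replicate n y) ≡ m + n
length-replicate₂ m n x y = trans (length-++ (replicate m x)) (cong₂ _+_ (length-replicate m) (length-replicate n))

length-replicate₃ : ∀ {A : Set} m n o (x y z : A) →
  length ((replicate m x ++ replicate n y) ++ replicate o z) ≡ m + n + o
length-replicate₃ m n o x y z =
  trans (length-++ (replicate m x ++ replicate n y)) (cong₂ _+_ (length-replicate₂ m n x y) (length-replicate o))

[h+j]∸[g+j]≡h : ∀ h g j → h ≡ 0 ⊎ g ≡ 0 → h + j ∸ (g + j) ≡ h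
[h+j]∸[g+j]≡h .0 g j (inj₁ refl) = m≤n⇒m∸n≡0 (m≤n+m j g)
[h+j]∸[g+j]≡h h .0 j (inj₂ refl) = m+n∸n≡m h j

∸-suc-≤ : ∀ k q → k ∸ q ≤ suc (k ∸ suc q)
∸-suc-≤ zero    zero    = z≤n
∸-suc-≤ zero    (suc q) = z≤n
∸-suc-≤ (suc k) zero    = ≤-refl
∸-suc-≤ (suc k) (suc q) = ∸-suc-≤ k q

Coords : Set
Coords = ℕ × ℕ × ℕ

-- νab a b is definitionally ⟦ a , b , 0 ⟧ and νhat a b k is ⟦ a + b ∸ k , k , 0 ⟧.
⟦_⟧ : Coords → Path
⟦ p , q , r ⟧ = Es p ++ N ∷ Es q ++ N ∷ Es r

NuCoords : ℕ → ℕ → Coords → Set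
NuCoords a b (p , q , r) = p ≤ a × p + (q + r) ≡ a + b

countN-++ : ∀ xs ys → countN (xs ++ ys) ≡ countN xs + countN ys
countN-++ []       ys = refl
countN-++ (N ∷ xs) ys = cong suc (countN-++ xs ys)
countN-++ (E ∷ xs) ys = countN-++ xs ys

countE-++ : ∀ xs ys → countE (xs ++ ys) ≡ countE xs + countE ys
countE-++ []       ys = refl
countE-++ (N ∷ xs) ys = countE-++ xs ys
countE-++ (E ∷ xs) ys = cong suc (countE-++ xs ys)

countN-Es : ∀ n → countN (Es n) ≡ 0
countN-Es zero    = refl
countN-Es (suc n) = countN-Es n

countE-Es : ∀ n → countE (Es n) ≡ n
countE-Es zero    = refl
countE-Es (suc n) = cong suc (countE-Es n)

countN-⟦⟧ : ∀ p q r → countN ⟦ p , q , r ⟧ ≡ 2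
countN-⟦⟧ p q r
  rewrite countN-++ (Es p) (N ∷ Es q ++ N ∷ Es r) | countN-Es p
        | countN-++ (Es q) (N ∷ Es r) | countN-Es q | countN-Es r = refl

countE-⟦⟧ : ∀ p q r → countE ⟦ p , q , r ⟧ ≡ p + (q + r)
countE-⟦⟧ p q r
  rewrite countE-++ (Es p) (N ∷ Es q ++ N ∷ Es r) | countE-Es p
        | countE-++ (Es q) (N ∷ Es r) | countE-Es q | countE-Es r = refl

countN-take-Es-++ : ∀ n t w → countN (take t (Es n ++ w)) ≡ countN (take (t ∸ n) w)
countN-take-Es-++ zero    t       w = refl
countN-take-Es-++ (suc n) zero    w = refl
countN-take-Es-++ (suc n) (suc t) w = countN-take-Es-++ n t w

countN-take-Es : ∀ n t → countN (take t (Es n)) ≡ 0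
countN-take-Es zero    zero    = refl
countN-take-Es zero    (suc t) = refl
countN-take-Es (suc n) zero    = refl
countN-take-Es (suc n) (suc t) = countN-take-Es n t

-- 1 ⊓ x is the indicator of x > 0.
countN-take-⟦⟧ : ∀ p q r t → countN (take t ⟦ p , q , r ⟧) ≡ 1 ⊓ (t ∸ p) + 1 ⊓ (t ∸ p ∸ suc q)
countN-take-⟦⟧ p q r t = trans (countN-take-Es-++ p t _) (after-first (t ∸ p))
  where
  after-second : ∀ s → countN (take s (N ∷ Es r)) ≡ 1 ⊓ s
  after-second zero    = refl
  after-second (suc s) = cong suc (countN-take-Es r s)

  after-first : ∀ s → countN (take s (N ∷ Es q ++ N ∷ Es r)) ≡ 1 ⊓ s + 1 ⊓ (s ∸ suc q)
  after-first zero    = refl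
  after-first (suc s) = cong suc (trans (countN-take-Es-++ q s _) (after-second (s ∸ q)))

NuCoords⇒IsNuPath : ∀ {a b} c → NuCoords a b c → IsNuPath (νab a b) ⟦ c ⟧
NuCoords⇒IsNuPath {a} {b} (p , q , r) (p≤a , total) =
  trans (countN-⟦⟧ p q r) (sym (countN-⟦⟧ a b 0)) ,
  trans (countE-⟦⟧ p q r) (trans total (sym (trans (countE-⟦⟧ a b 0) (cong (a +_) (+-identityʳ b))))) ,
  above
  where
  second≤ : p + suc q ≤ a + suc b
  second≤ = subst₂ _≤_ (sym (+-suc p q)) (sym (+-suc a b))
                   (s≤s (subst (p + q ≤_) total (+-monoʳ-≤ p (m≤m+n q r))))

  above : ∀ t → countN (take t (νab a b)) ≤ countN (take t ⟦ p , q , r ⟧)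
  above t rewrite countN-take-⟦⟧ a b 0 t | countN-take-⟦⟧ p q r t
                | ∸-+-assoc t a (suc b) | ∸-+-assoc t p (suc q) =
    +-mono-≤ (⊓-monoʳ-≤ 1 (∸-monoʳ-≤ t p≤a)) (⊓-monoʳ-≤ 1 (∸-monoʳ-≤ t second≤))

split-N : ∀ μ {n} → countN μ ≡ suc n → Σ[ p ∈ ℕ ] Σ[ w ∈ Path ] μ ≡ Es p ++ N ∷ w × countN w ≡ n
split-N (N ∷ μ) refl = 0 , μ , refl , refl
split-N (E ∷ μ) eq with split-N μ eq
... | p , w , refl , c = suc p , w , refl , c

countN≡0⇒Es : ∀ w → countN w ≡ 0 → w ≡ Es (countE w)
countN≡0⇒Es []      _  = refl
countN≡0⇒Es (E ∷ w) eq = cong (E ∷_) (countN≡0⇒Es w eq)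

above⇒p≤a : ∀ {a b p q r} → (∀ t → countN (take t (νab a b)) ≤ countN (take t ⟦ p , q , r ⟧)) → p ≤ a
above⇒p≤a {a} {b} {p} {q} {r} above =
  ≮⇒≥ λ a<p → n≮0 (subst (0 <_) (before-first a<p) (≤-trans at-a+1 (above (suc a))))
  where
  at-a+1 : 0 < countN (take (suc a) ⟦ a , b , 0 ⟧)
  at-a+1 rewrite countN-take-⟦⟧ a b 0 (suc a) | m+n∸n≡m 1 a = s≤s z≤n

  before-first : a < p → countN (take (suc a) ⟦ p , q , r ⟧) ≡ 0
  before-first a<p rewrite countN-take-⟦⟧ p q r (suc a) | m≤n⇒m∸n≡0 a<p = refl

IsNuPath⇒NuCoords : ∀ {a b μ} → IsNuPath (νab a b) μ → Σ[ c ∈ Coords ] μ ≡ ⟦ c ⟧ × NuCoords a b c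
IsNuPath⇒NuCoords {a} {b} {μ} (sameN , sameE , above)
  with split-N μ (trans sameN (countN-⟦⟧ a b 0))
... | p , w , refl , oneN with split-N w oneN
... | q , w′ , refl , noN = (p , q , r) , μ≡ , above⇒p≤a (subst (λ μ → ∀ t → _ ≤ countN (take t μ)) μ≡ above) , total
  where
  r : ℕ
  r = countE w′
  μ≡ : Es p ++ N ∷ Es q ++ N ∷ w′ ≡ ⟦ p , q , r ⟧
  μ≡ = cong (λ w → Es p ++ N ∷ Es q ++ N ∷ w) (countN≡0⇒Es w′ noN)
  total : p + (q + r) ≡ a + b
  total = begin
    p + (q + r)     ≡⟨ countE-⟦⟧ p q r ⟨
    countE ⟦ p , q , r ⟧ ≡⟨ cong countE μ≡ ⟨
    countE (Es p ++ N ∷ Es q ++ N ∷ w′) ≡⟨ sameE ⟩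
    countE (νab a b) ≡⟨ countE-⟦⟧ a b 0 ⟩
    a + (b + 0)     ≡⟨ cong (a +_) (+-identityʳ b) ⟩
    a + b           ∎
    where open ≡-Reasoning

k≤q+r : ∀ {a b k} p q r → k ≤ b → NuCoords a b (p , q , r) → k ≤ q + r
k≤q+r {a} {b} {k} p q r k≤b (p≤a , total) =
  ≤-trans k≤b (+-cancelˡ-≤ a b (q + r) (subst (_≤ a + (q + r)) total (+-monoˡ-≤ (q + r) p≤a)))

blank : ℕ → List (Maybe ℕ)
blank n = replicate n nothing

block : ℕ → ℕ → List (Maybe ℕ)
block i n = replicate n (just i)

holes : List (Maybe ℕ) → ℕ
holes []             = 0
holes (nothing ∷ xs) = suc (holes xs)
holes (just _ ∷ xs)  = holes xs

holes-++ : ∀ xs ys → holes (xs ++ ys) ≡ holes xs + holes ys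
holes-++ []             ys = refl
holes-++ (nothing ∷ xs) ys = cong suc (holes-++ xs ys)
holes-++ (just _ ∷ xs)  ys = holes-++ xs ys

holes-reverse : ∀ xs → holes (reverse xs) ≡ holes xs
holes-reverse []       = refl
holes-reverse (x ∷ xs) = begin
  holes (reverse (x ∷ xs))         ≡⟨ cong holes (unfold-reverse x xs) ⟩
  holes (reverse xs ++ x ∷ [])     ≡⟨ holes-++ (reverse xs) (x ∷ []) ⟩
  holes (reverse xs) + holes (x ∷ []) ≡⟨ cong (_+ holes (x ∷ [])) (holes-reverse xs) ⟩
  holes xs + holes (x ∷ [])        ≡⟨ +-comm (holes xs) _ ⟩
  holes (x ∷ []) + holes xs        ≡⟨ holes-∷ x ⟩
  holes (x ∷ xs)                   ∎
  where
  open ≡-Reasoning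
  holes-∷ : ∀ x → holes (x ∷ []) + holes xs ≡ holes (x ∷ xs)
  holes-∷ nothing  = refl
  holes-∷ (just _) = refl

holes-blank : ∀ n → holes (blank n) ≡ n
holes-blank zero    = refl
holes-blank (suc n) = cong suc (holes-blank n)

holes-block : ∀ i n → holes (block i n) ≡ 0
holes-block i zero    = refl
holes-block i (suc n) = holes-block i n

fillScan-++ : ∀ i c xs ys → fillScan i c (xs ++ ys) ≡ fillScan i c xs ++ fillScan i (c ∸ holes xs) ys
fillScan-++ i zero    xs             ys rewrite 0∸n≡0 (holes xs) = refl
fillScan-++ i (suc c) []             ys = refl
fillScan-++ i (suc c) (nothing ∷ xs) ys = cong (just i ∷_) (fillScan-++ i c xs ys)
fillScan-++ i (suc c) (just x ∷ xs)  ys = cong (just x ∷_) (fillScan-++ i (suc c) xs ys)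

fillScan-saturated : ∀ i c xs → holes xs ≤ c → fillScan i c xs ≡ map (_<∣> just i) xs
fillScan-saturated i zero    []             _       = refl
fillScan-saturated i (suc c) []             _       = refl
fillScan-saturated i zero    (just x ∷ xs)  h       = cong (just x ∷_) (fillScan-saturated i zero xs h)
fillScan-saturated i (suc c) (nothing ∷ xs) (s≤s h) = cong (just i ∷_) (fillScan-saturated i c xs h)
fillScan-saturated i (suc c) (just x ∷ xs)  h       = cong (just x ∷_) (fillScan-saturated i (suc c) xs h)

fillFromRight : ℕ → ℕ → List (Maybe ℕ) → List (Maybe ℕ)
fillFromRight i c xs = reverse (fillScan i c (reverse xs))

fillFromRight-++ : ∀ i c xs ys →
  fillFromRight i c (xs ++ ys) ≡ fillFromRight i (c ∸ holes ys) xs ++ fillFromRight i c ys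
fillFromRight-++ i c xs ys = begin
  reverse (fillScan i c (reverse (xs ++ ys)))
    ≡⟨ cong (reverse ∘ fillScan i c) (reverse-++ xs ys) ⟩
  reverse (fillScan i c (reverse ys ++ reverse xs))
    ≡⟨ cong reverse (fillScan-++ i c (reverse ys) (reverse xs)) ⟩
  reverse (fillScan i c (reverse ys) ++ fillScan i (c ∸ holes (reverse ys)) (reverse xs))
    ≡⟨ reverse-++ (fillScan i c (reverse ys)) _ ⟩
  fillFromRight i (c ∸ holes (reverse ys)) xs ++ fillFromRight i c ys
    ≡⟨ cong (λ h → fillFromRight i (c ∸ h) xs ++ fillFromRight i c ys) (holes-reverse ys) ⟩
  fillFromRight i (c ∸ holes ys) xs ++ fillFromRight i c ys ∎
  where open ≡-Reasoning

fillFromRight-zero : ∀ i xs → fillFromRight i 0 xs ≡ xs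
fillFromRight-zero i = reverse-involutive

fillFromRight-saturated : ∀ i c xs → holes xs ≤ c → fillFromRight i c xs ≡ map (_<∣> just i) xs
fillFromRight-saturated i c xs h = begin
  reverse (fillScan i c (reverse xs))       ≡⟨ cong reverse (fillScan-saturated i c (reverse xs) h′) ⟩
  reverse (map (_<∣> just i) (reverse xs))  ≡⟨ reverse-map (_<∣> just i) (reverse xs) ⟨
  map (_<∣> just i) (reverse (reverse xs))  ≡⟨ cong (map (_<∣> just i)) (reverse-involutive xs) ⟩
  map (_<∣> just i) xs                      ∎
  where
  open ≡-Reasoning
  h′ : holes (reverse xs) ≤ c
  h′ = subst (_≤ c) (sym (holes-reverse xs)) h

fillFromRight-++-blank : ∀ i c xs n → fillFromRight i (c + n) (xs ++ blank n) ≡ fillFromRight i c xs ++ block i n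
fillFromRight-++-blank i c xs n = begin
  fillFromRight i (c + n) (xs ++ blank n)
    ≡⟨ fillFromRight-++ i (c + n) xs (blank n) ⟩
  fillFromRight i (c + n ∸ holes (blank n)) xs ++ fillFromRight i (c + n) (blank n)
    ≡⟨ cong₂ (λ h ys → fillFromRight i (c + n ∸ h) xs ++ ys) (holes-blank n)
             (fillFromRight-saturated i (c + n) (blank n) (subst (_≤ c + n) (sym (holes-blank n)) (m≤n+m n c))) ⟩
  fillFromRight i (c + n ∸ n) xs ++ map (_<∣> just i) (blank n)
    ≡⟨ cong₂ (λ d ys → fillFromRight i d xs ++ ys) (m+n∸n≡m c n) (map-replicate (_<∣> just i) n nothing) ⟩
  fillFromRight i c xs ++ block i n ∎
  where open ≡-Reasoning

fillFromRight-blank : ∀ i m n → fillFromRight i n (blank (m + n)) ≡ blank m ++ block i n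
fillFromRight-blank i m n = begin
  fillFromRight i n (blank (m + n))         ≡⟨ cong (fillFromRight i n) (replicate-+ m n nothing) ⟩
  fillFromRight i (0 + n) (blank m ++ blank n) ≡⟨ fillFromRight-++-blank i 0 (blank m) n ⟩
  fillFromRight i 0 (blank m) ++ block i n  ≡⟨ cong (_++ block i n) (fillFromRight-zero i (blank m)) ⟩
  blank m ++ block i n                      ∎
  where open ≡-Reasoning

fillFromRight-++-block : ∀ i c xs x n → fillFromRight i c (xs ++ block x n) ≡ fillFromRight i c xs ++ block x n
fillFromRight-++-block i c xs x n = begin
  fillFromRight i c (xs ++ block x n)
    ≡⟨ fillFromRight-++ i c xs (block x n) ⟩
  fillFromRight i (c ∸ holes (block x n)) xs ++ fillFromRight i c (block x n)
    ≡⟨ cong₂ (λ h ys → fillFromRight i (c ∸ h) xs ++ ys) (holes-block x n)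
             (fillFromRight-saturated i c (block x n) (subst (_≤ c) (sym (holes-block x n)) z≤n)) ⟩
  fillFromRight i c xs ++ map (_<∣> just i) (block x n)
    ≡⟨ cong (fillFromRight i c xs ++_) (map-replicate (_<∣> just i) n (just x)) ⟩
  fillFromRight i c xs ++ block x n ∎
  where open ≡-Reasoning

fillFromRight-∷-blank : ∀ i x c g → c ≡ 0 ⊎ g ≡ 0 → fillFromRight i c (just x ∷ blank g) ≡ just x ∷ blank g
fillFromRight-∷-blank i x .0 g (inj₁ refl) = fillFromRight-zero i (just x ∷ blank g)
fillFromRight-∷-blank i x c .0 (inj₂ refl) = fillFromRight-saturated i c (just x ∷ []) z≤n

fillFromRight-blank-blocks : ∀ i n x a y b →
  fillFromRight i n ((blank n ++ block x a) ++ block y b) ≡ (block i n ++ block x a) ++ block y b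
fillFromRight-blank-blocks i n x a y b = begin
  fillFromRight i n ((blank n ++ block x a) ++ block y b)  ≡⟨ fillFromRight-++-block i n (blank n ++ block x a) y b ⟩
  fillFromRight i n (blank n ++ block x a) ++ block y b    ≡⟨ cong (_++ block y b) (fillFromRight-++-block i n (blank n) x a) ⟩
  (fillFromRight i n (blank n) ++ block x a) ++ block y b  ≡⟨ cong (λ xs → (xs ++ block x a) ++ block y b) (fillFromRight-blank i 0 n) ⟩
  (block i n ++ block x a) ++ block y b                    ∎
  where open ≡-Reasoning

fillFromRight-∷-blank-block : ∀ i c x g y j →
  fillFromRight i (c + g) (just x ∷ blank g ++ block y j) ≡ just x ∷ block i g ++ block y j
fillFromRight-∷-blank-block i c x g y j = begin
  fillFromRight i (c + g) ((just x ∷ blank g) ++ block y j)     ≡⟨ fillFromRight-++-block i (c + g) (just x ∷ blank g) y j ⟩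
  fillFromRight i (c + g) (just x ∷ blank g) ++ block y j       ≡⟨ cong (_++ block y j) (fillFromRight-++-blank i c (just x ∷ []) g) ⟩
  (fillFromRight i c (just x ∷ []) ++ block i g) ++ block y j  ≡⟨ cong (λ xs → (xs ++ block i g) ++ block y j)
                                                                        (fillFromRight-saturated i c (just x ∷ []) z≤n) ⟩
  just x ∷ block i g ++ block y j                               ∎
  where open ≡-Reasoning

fillLeft-++ : ∀ i c {f} xs ys → length xs ≡ f → fillLeft i c f (xs ++ ys) ≡ fillFromRight i c xs ++ ys
fillLeft-++ i c xs ys refl = cong₂ (λ zs ws → fillFromRight i c zs ++ ws) (take-length-++ xs ys) (drop-length-++ xs ys)

ysFrom-Es-++ : ∀ y n w → ysFrom y (Es n ++ w) ≡ replicate n y ++ ysFrom y w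
ysFrom-Es-++ y zero    w = refl
ysFrom-Es-++ y (suc n) w = cong (y ∷_) (ysFrom-Es-++ y n w)

ysFrom-Es : ∀ y n → ysFrom y (Es n) ≡ replicate n y ++ y ∷ []
ysFrom-Es y zero    = refl
ysFrom-Es y (suc n) = cong (y ∷_) (ysFrom-Es y n)

ys-⟦⟧ : ∀ p q r → ys ⟦ p , q , r ⟧ ≡ replicate p 0 ++ 0 ∷ replicate q 1 ++ 1 ∷ replicate r 2 ++ 2 ∷ []
ys-⟦⟧ p q r
  rewrite ysFrom-Es-++ 0 p (N ∷ Es q ++ N ∷ Es r) | ysFrom-Es-++ 1 q (N ∷ Es r) | ysFrom-Es 2 r = refl

countEq-replicate-++ : ∀ i n xs → countEq i (replicate n i ++ xs) ≡ n + countEq i xs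
countEq-replicate-++ i zero    xs = refl
countEq-replicate-++ i (suc n) xs with i ≟ i
... | yes _   = cong suc (countEq-replicate-++ i n xs)
... | no i≢i = ⊥-elim (i≢i refl)

countEq-replicate-≢-++ : ∀ i x n xs → x ≢ i → countEq i (replicate n x ++ xs) ≡ countEq i xs
countEq-replicate-≢-++ i x zero    xs _   = refl
countEq-replicate-≢-++ i x (suc n) xs x≢i with x ≟ i
... | yes x≡i = ⊥-elim (x≢i x≡i)
... | no _    = countEq-replicate-≢-++ i x n xs x≢i

lastIdxFrom-replicate-++ : ∀ i n pos acc xs →
  lastIdxFrom i pos acc (replicate n i ++ i ∷ xs) ≡ lastIdxFrom i (suc (n + pos)) (n + pos) xs
lastIdxFrom-replicate-++ i zero pos acc xs with i ≟ i
... | yes _   = refl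
... | no i≢i = ⊥-elim (i≢i refl)
lastIdxFrom-replicate-++ i (suc n) pos acc xs with i ≟ i
... | yes _   = trans (lastIdxFrom-replicate-++ i n (suc pos) pos xs)
                      (cong (λ m → lastIdxFrom i (suc m) m xs) (+-suc n pos))
... | no i≢i = ⊥-elim (i≢i refl)

lastIdxFrom-replicate-≢-++ : ∀ i x n pos acc xs → x ≢ i →
  lastIdxFrom i pos acc (replicate n x ++ xs) ≡ lastIdxFrom i (n + pos) acc xs
lastIdxFrom-replicate-≢-++ i x zero    pos acc xs _   = refl
lastIdxFrom-replicate-≢-++ i x (suc n) pos acc xs x≢i with x ≟ i
... | yes x≡i = ⊥-elim (x≢i x≡i)
... | no _    = trans (lastIdxFrom-replicate-≢-++ i x n (suc pos) acc xs x≢i)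
                      (cong (λ m → lastIdxFrom i m acc xs) (+-suc n pos))

points-at-height₀-⟦⟧ : ∀ p q r → countEq 0 (ys ⟦ p , q , r ⟧) ≡ suc p
points-at-height₀-⟦⟧ p q r
  rewrite ys-⟦⟧ p q r | countEq-replicate-++ 0 p (0 ∷ replicate q 1 ++ 1 ∷ replicate r 2 ++ 2 ∷ [])
        | countEq-replicate-≢-++ 0 1 q (1 ∷ replicate r 2 ++ 2 ∷ []) (λ ())
        | countEq-replicate-≢-++ 0 2 r (2 ∷ []) (λ ()) = +-comm p 1

points-at-height₁-⟦⟧ : ∀ p q r → countEq 1 (ys ⟦ p , q , r ⟧) ≡ suc q
points-at-height₁-⟦⟧ p q r
  rewrite ys-⟦⟧ p q r | countEq-replicate-≢-++ 1 0 p (0 ∷ replicate q 1 ++ 1 ∷ replicate r 2 ++ 2 ∷ []) (λ ())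
        | countEq-replicate-++ 1 q (1 ∷ replicate r 2 ++ 2 ∷ [])
        | countEq-replicate-≢-++ 1 2 r (2 ∷ []) (λ ()) = +-comm q 1

points-at-height₂-⟦⟧ : ∀ p q r → countEq 2 (ys ⟦ p , q , r ⟧) ≡ suc r
points-at-height₂-⟦⟧ p q r
  rewrite ys-⟦⟧ p q r | countEq-replicate-≢-++ 2 0 p (0 ∷ replicate q 1 ++ 1 ∷ replicate r 2 ++ 2 ∷ []) (λ ())
        | countEq-replicate-≢-++ 2 1 q (1 ∷ replicate r 2 ++ 2 ∷ []) (λ ())
        | countEq-replicate-++ 2 r (2 ∷ []) = +-comm r 1

fixedPos₀-⟦⟧ : ∀ m k → fixedPos ⟦ m , k , 0 ⟧ 0 ≡ m
fixedPos₀-⟦⟧ m k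
  rewrite ys-⟦⟧ m k 0 | lastIdxFrom-replicate-++ 0 m 0 0 (replicate k 1 ++ 1 ∷ 2 ∷ [])
        | lastIdxFrom-replicate-≢-++ 0 1 k (suc (m + 0)) (m + 0) (1 ∷ 2 ∷ []) (λ ()) = +-identityʳ m

fixedPos₁-⟦⟧ : ∀ m k → fixedPos ⟦ m , k , 0 ⟧ 1 ≡ m + suc k
fixedPos₁-⟦⟧ m k
  rewrite ys-⟦⟧ m k 0 | lastIdxFrom-replicate-≢-++ 1 0 m 0 0 (0 ∷ replicate k 1 ++ 1 ∷ 2 ∷ []) (λ ())
        | lastIdxFrom-replicate-++ 1 k (suc (m + 0)) 0 (2 ∷ []) | +-identityʳ m = trans (+-comm k (suc m)) (sym (+-suc m k))

fixedPos₂-⟦⟧ : ∀ m k → fixedPos ⟦ m , k , 0 ⟧ 2 ≡ m + suc (k + 1)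
fixedPos₂-⟦⟧ m k
  rewrite ys-⟦⟧ m k 0 | lastIdxFrom-replicate-≢-++ 2 0 m 0 0 (0 ∷ replicate k 1 ++ 1 ∷ 2 ∷ []) (λ ())
        | lastIdxFrom-replicate-≢-++ 2 1 k (suc (m + 0)) 0 (1 ∷ 2 ∷ []) (λ ()) | +-identityʳ m = arith m k
  where
  arith : ∀ m k → suc (k + suc m) ≡ m + suc (k + 1)
  arith = solve-∀

setAt-replicate-++ : ∀ n j v (x : Maybe ℕ) xs → setAt (n + j) v (replicate n x ++ xs) ≡ replicate n x ++ setAt j v xs
setAt-replicate-++ zero    j v x xs = refl
setAt-replicate-++ (suc n) j v x xs = cong (x ∷_) (setAt-replicate-++ n j v x xs)

setAt-replicate-++-∷ : ∀ n v (x y : Maybe ℕ) xs → setAt n v (replicate n x ++ y ∷ xs) ≡ replicate n x ++ just v ∷ xs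
setAt-replicate-++-∷ zero    v x y xs = refl
setAt-replicate-++-∷ (suc n) v x y xs = cong (x ∷_) (setAt-replicate-++-∷ n v x y xs)

blank-length-⟦⟧ : ∀ m k → blank (suc (length ⟦ m , k , 0 ⟧)) ≡ blank m ++ nothing ∷ blank k ++ nothing ∷ nothing ∷ []
blank-length-⟦⟧ m k = begin
  blank (suc (length ⟦ m , k , 0 ⟧)) ≡⟨ cong (blank ∘ suc) length≡ ⟩
  blank (suc (m + suc (k + 1)))       ≡⟨ cong blank (arith m k) ⟩
  blank (m + suc (k + 2))             ≡⟨ replicate-+ m (suc (k + 2)) nothing ⟩
  blank m ++ nothing ∷ blank (k + 2)  ≡⟨ cong (λ xs → blank m ++ nothing ∷ xs) (replicate-+ k 2 nothing) ⟩
  blank m ++ nothing ∷ blank k ++ nothing ∷ nothing ∷ [] ∎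
  where
  open ≡-Reasoning
  length≡ : length ⟦ m , k , 0 ⟧ ≡ m + suc (k + 1)
  length≡ rewrite length-++ (Es m) {N ∷ Es k ++ N ∷ []} | length-++ (Es k) {N ∷ []}
                | length-replicate m {E} | length-replicate k {E} = refl
  arith : ∀ m k → suc (m + suc (k + 1)) ≡ m + suc (k + 2)
  arith = solve-∀

fixed-entries : ∀ m k → setAt (m + suc (k + 1)) 2 (setAt (m + suc k) 1 (setAt m 0
                 (blank m ++ nothing ∷ blank k ++ nothing ∷ nothing ∷ [])))
               ≡ blank m ++ just 0 ∷ blank k ++ just 1 ∷ just 2 ∷ []
fixed-entries m k
  rewrite setAt-replicate-++-∷ m 0 nothing nothing (blank k ++ nothing ∷ nothing ∷ [])
        | setAt-replicate-++ m (suc k) 1 nothing (just 0 ∷ blank k ++ nothing ∷ nothing ∷ [])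
        | setAt-replicate-++-∷ k 1 nothing nothing (nothing ∷ [])
        | setAt-replicate-++ m (suc (k + 1)) 2 nothing (just 0 ∷ blank k ++ just 1 ∷ nothing ∷ [])
        | setAt-replicate-++ k 1 2 nothing (just 1 ∷ nothing ∷ []) = refl

bracket-⟦⟧ : ∀ m k p q r → bracket ⟦ m , k , 0 ⟧ ⟦ p , q , r ⟧ ≡
  fillLeft 2 r (m + suc (k + 1)) (fillLeft 1 q (m + suc k) (fillLeft 0 p m
    (blank m ++ just 0 ∷ blank k ++ just 1 ∷ just 2 ∷ [])))
bracket-⟦⟧ m k p q r
  rewrite countN-⟦⟧ m k 0 | blank-length-⟦⟧ m k
        | fixedPos₀-⟦⟧ m k | fixedPos₁-⟦⟧ m k | fixedPos₂-⟦⟧ m k | fixed-entries m k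
        | points-at-height₀-⟦⟧ p q r | points-at-height₁-⟦⟧ p q r | points-at-height₂-⟦⟧ p q r = refl

fill₀ : ∀ e h p tail → fillLeft 0 p (e + h + p) (blank (e + h + p) ++ just 0 ∷ tail)
                      ≡ (blank (e + h) ++ block 0 p) ++ just 0 ∷ tail
fill₀ e h p tail = trans (fillLeft-++ 0 p (blank (e + h + p)) (just 0 ∷ tail) (length-replicate (e + h + p)))
                         (cong (_++ just 0 ∷ tail) (fillFromRight-blank 0 (e + h) p))

fill₁ : ∀ e h p g j tail → h ≡ 0 ⊎ g ≡ 0 →
  fillLeft 1 (h + j) (e + h + p + suc (g + j)) ((blank (e + h) ++ block 0 p) ++ just 0 ∷ blank (g + j) ++ tail)
  ≡ ((blank e ++ block 1 h) ++ block 0 p) ++ just 0 ∷ (blank g ++ block 1 j) ++ tail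
fill₁ e h p g j tail h0⊎g0 = begin
  fillLeft 1 (h + j) F (X ++ just 0 ∷ blank (g + j) ++ tail)
    ≡⟨ cong (fillLeft 1 (h + j) F) (++-assoc X (just 0 ∷ blank (g + j)) tail) ⟨
  fillLeft 1 (h + j) F ((X ++ just 0 ∷ blank (g + j)) ++ tail)
    ≡⟨ fillLeft-++ 1 (h + j) (X ++ just 0 ∷ blank (g + j)) tail length≡ ⟩
  fillFromRight 1 (h + j) (X ++ just 0 ∷ blank (g + j)) ++ tail
    ≡⟨ cong (_++ tail) (fillFromRight-++ 1 (h + j) X (just 0 ∷ blank (g + j))) ⟩
  (fillFromRight 1 (h + j ∸ holes (blank (g + j))) X ++ fillFromRight 1 (h + j) (just 0 ∷ blank (g + j))) ++ tail
    ≡⟨ cong₂ (λ xs ys → (xs ++ ys) ++ tail) left right ⟩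
  (((blank e ++ block 1 h) ++ block 0 p) ++ just 0 ∷ blank g ++ block 1 j) ++ tail
    ≡⟨ ++-assoc ((blank e ++ block 1 h) ++ block 0 p) (just 0 ∷ blank g ++ block 1 j) tail ⟩
  ((blank e ++ block 1 h) ++ block 0 p) ++ just 0 ∷ (blank g ++ block 1 j) ++ tail ∎
  where
  open ≡-Reasoning
  X : List (Maybe ℕ)
  X = blank (e + h) ++ block 0 p
  F : ℕ
  F = e + h + p + suc (g + j)

  length≡ : length (X ++ just 0 ∷ blank (g + j)) ≡ e + h + p + suc (g + j)
  length≡ = trans (length-++ X) (cong₂ (λ x y → x + suc y)
                    (length-replicate₂ (e + h) p nothing (just 0)) (length-replicate (g + j)))

  left : fillFromRight 1 (h + j ∸ holes (blank (g + j))) X ≡ (blank e ++ block 1 h) ++ block 0 p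
  left = begin
    fillFromRight 1 (h + j ∸ holes (blank (g + j))) X ≡⟨ cong (λ n → fillFromRight 1 (h + j ∸ n) X) (holes-blank (g + j)) ⟩
    fillFromRight 1 (h + j ∸ (g + j)) X               ≡⟨ cong (λ c → fillFromRight 1 c X) ([h+j]∸[g+j]≡h h g j h0⊎g0) ⟩
    fillFromRight 1 h X                               ≡⟨ fillFromRight-++-block 1 h (blank (e + h)) 0 p ⟩
    fillFromRight 1 h (blank (e + h)) ++ block 0 p    ≡⟨ cong (_++ block 0 p) (fillFromRight-blank 1 e h) ⟩
    (blank e ++ block 1 h) ++ block 0 p               ∎

  right : fillFromRight 1 (h + j) (just 0 ∷ blank (g + j)) ≡ just 0 ∷ blank g ++ block 1 j
  right = begin
    fillFromRight 1 (h + j) (just 0 ∷ blank (g + j))      ≡⟨ cong (λ xs → fillFromRight 1 (h + j) (just 0 ∷ xs)) (replicate-+ g j nothing) ⟩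
    fillFromRight 1 (h + j) ((just 0 ∷ blank g) ++ blank j) ≡⟨ fillFromRight-++-blank 1 h (just 0 ∷ blank g) j ⟩
    fillFromRight 1 h (just 0 ∷ blank g) ++ block 1 j     ≡⟨ cong (_++ block 1 j) (fillFromRight-∷-blank 1 0 h g h0⊎g0) ⟩
    just 0 ∷ blank g ++ block 1 j                          ∎

fill₂ : ∀ e h p g j →
  fillLeft 2 (e + g) (e + h + p + suc (g + j + 1))
    (((blank e ++ block 1 h) ++ block 0 p) ++ just 0 ∷ (blank g ++ block 1 j) ++ just 1 ∷ just 2 ∷ [])
  ≡ ((block 2 e ++ block 1 h) ++ block 0 p) ++ just 0 ∷ (block 2 g ++ block 1 j) ++ just 1 ∷ just 2 ∷ []
fill₂ e h p g j = begin
  fillLeft 2 (e + g) F (X ++ just 0 ∷ Y ++ just 1 ∷ just 2 ∷ [])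
    ≡⟨ cong (fillLeft 2 (e + g) F) (++-∷-++-∷-∷ X (just 0) Y (just 1) (just 2)) ⟩
  fillLeft 2 (e + g) F (((X ++ just 0 ∷ Y) ++ block 1 1) ++ just 2 ∷ [])
    ≡⟨ fillLeft-++ 2 (e + g) ((X ++ just 0 ∷ Y) ++ block 1 1) (just 2 ∷ []) length≡ ⟩
  fillFromRight 2 (e + g) ((X ++ just 0 ∷ Y) ++ block 1 1) ++ just 2 ∷ []
    ≡⟨ cong (_++ just 2 ∷ []) (fillFromRight-++-block 2 (e + g) (X ++ just 0 ∷ Y) 1 1) ⟩
  (fillFromRight 2 (e + g) (X ++ just 0 ∷ Y) ++ just 1 ∷ []) ++ just 2 ∷ []
    ≡⟨ cong (λ xs → (xs ++ just 1 ∷ []) ++ just 2 ∷ []) (fillFromRight-++ 2 (e + g) X (just 0 ∷ Y)) ⟩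
  ((fillFromRight 2 (e + g ∸ holes Y) X ++ fillFromRight 2 (e + g) (just 0 ∷ Y)) ++ just 1 ∷ []) ++ just 2 ∷ []
    ≡⟨ cong₂ (λ xs ys → ((xs ++ ys) ++ just 1 ∷ []) ++ just 2 ∷ []) left (fillFromRight-∷-blank-block 2 e 0 g 1 j) ⟩
  ((X′ ++ just 0 ∷ Y′) ++ just 1 ∷ []) ++ just 2 ∷ []
    ≡⟨ ++-∷-++-∷-∷ X′ (just 0) Y′ (just 1) (just 2) ⟨
  X′ ++ just 0 ∷ Y′ ++ just 1 ∷ just 2 ∷ [] ∎
  where
  open ≡-Reasoning
  X Y X′ Y′ : List (Maybe ℕ)
  X = (blank e ++ block 1 h) ++ block 0 p
  Y = blank g ++ block 1 j
  X′ = (block 2 e ++ block 1 h) ++ block 0 p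
  Y′ = block 2 g ++ block 1 j
  F : ℕ
  F = e + h + p + suc (g + j + 1)

  length≡ : length ((X ++ just 0 ∷ Y) ++ block 1 1) ≡ F
  length≡ = trans (length-++ (X ++ just 0 ∷ Y))
              (trans (cong (_+ 1) (trans (length-++ X) (cong₂ (λ x y → x + suc y)
                                                         (length-replicate₃ e h p nothing (just 1) (just 0))
                                                         (length-replicate₂ g j nothing (just 1)))))
                     (+-assoc (e + h + p) (suc (g + j)) 1))

  holesY : holes Y ≡ g
  holesY = trans (holes-++ (blank g) (block 1 j)) (trans (cong₂ _+_ (holes-blank g) (holes-block 1 j)) (+-identityʳ g))

  left : fillFromRight 2 (e + g ∸ holes Y) X ≡ X′
  left = trans (cong (λ n → fillFromRight 2 (e + g ∸ n) X) holesY)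
               (trans (cong (λ c → fillFromRight 2 c X) (m+n∸n≡m e g)) (fillFromRight-blank-blocks 2 e 1 h 0 p))

bracket-shape : ∀ e h p g j → h ≡ 0 ⊎ g ≡ 0 →
  bracket ⟦ e + h + p , g + j , 0 ⟧ ⟦ p , h + j , e + g ⟧
  ≡ ((block 2 e ++ block 1 h) ++ block 0 p) ++ just 0 ∷ (block 2 g ++ block 1 j) ++ just 1 ∷ just 2 ∷ []
bracket-shape e h p g j h0⊎g0 =
  trans (bracket-⟦⟧ (e + h + p) (g + j) p (h + j) (e + g))
  (trans (cong (λ v → fillLeft 2 (e + g) F₂ (fillLeft 1 (h + j) F₁ v)) (fill₀ e h p (blank (g + j) ++ tail)))
  (trans (cong (fillLeft 2 (e + g) F₂) (fill₁ e h p g j tail h0⊎g0))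
         (fill₂ e h p g j)))
  where
  tail : List (Maybe ℕ)
  tail = just 1 ∷ just 2 ∷ []
  F₁ F₂ : ℕ
  F₁ = e + h + p + suc (g + j)
  F₂ = e + h + p + suc (g + j + 1)

countJust-++ : ∀ i xs ys → countJust i (xs ++ ys) ≡ countJust i xs + countJust i ys
countJust-++ i []             ys = refl
countJust-++ i (nothing ∷ xs) ys = countJust-++ i xs ys
countJust-++ i (just x ∷ xs)  ys with x ≟ i
... | yes _ = cong suc (countJust-++ i xs ys)
... | no _  = countJust-++ i xs ys

countJust-block : ∀ i n → countJust i (block i n) ≡ n
countJust-block i zero    = refl
countJust-block i (suc n) with i ≟ i
... | yes _   = cong suc (countJust-block i n)
... | no i≢i = ⊥-elim (i≢i refl)

countJust-block-≢ : ∀ i x n → x ≢ i → countJust i (block x n) ≡ 0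
countJust-block-≢ i x zero    _   = refl
countJust-block-≢ i x (suc n) x≢i with x ≟ i
... | yes x≡i = ⊥-elim (x≢i x≡i)
... | no _    = countJust-block-≢ i x n x≢i

suvOf : ℕ → ℕ → ℕ → Path → ℕ × ℕ × ℕ
suvOf a b k μ = sOf a b k μ , uOf a b k μ , vOf a b k μ

readTriple : ℕ → ℕ → List (Maybe ℕ) → ℕ × ℕ × ℕ
readTriple m k B = countJust 0 B ∸ 1 , countJust 2 (take m B) , countJust 2 (drop (suc m) (take (m + suc k) B))

suvOf-readTriple : ∀ a b k μ → suvOf a b k μ ≡ readTriple (a + b ∸ k) k (bvec a b k μ)
suvOf-readTriple a b k μ =
  cong₂ (λ f₀ f₁ → countJust 0 B ∸ 1 , countJust 2 (take f₀ B) , countJust 2 (drop (suc f₀) (take f₁ B)))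
        (fixedPos₀-⟦⟧ (a + b ∸ k) k) (fixedPos₁-⟦⟧ (a + b ∸ k) k)
  where
  B : List (Maybe ℕ)
  B = bvec a b k μ

readTriple-split : ∀ α β → readTriple (length α) (length β) (α ++ just 0 ∷ β ++ just 1 ∷ just 2 ∷ [])
                         ≡ (countJust 0 α + countJust 0 β , countJust 2 α , countJust 2 β)
readTriple-split α β = cong₂ _,_ zeros (cong₂ _,_ (cong (countJust 2) (take-length-++ α _)) (cong (countJust 2) βpart))
  where
  tail : List (Maybe ℕ)
  tail = just 1 ∷ just 2 ∷ []
  zeros : countJust 0 (α ++ just 0 ∷ β ++ tail) ∸ 1 ≡ countJust 0 α + countJust 0 β
  zeros rewrite countJust-++ 0 α (just 0 ∷ β ++ tail) | countJust-++ 0 β tail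
              | +-identityʳ (countJust 0 β) | +-suc (countJust 0 α) (countJust 0 β) = refl
  βpart : drop (suc (length α)) (take (length α + suc (length β)) (α ++ just 0 ∷ β ++ tail)) ≡ β
  βpart = begin
    drop (suc (length α)) (take (length α + suc (length β)) (α ++ just 0 ∷ β ++ tail))
      ≡⟨ cong₂ (λ n xs → drop (suc (length α)) (take n xs)) (length-++ α) (++-assoc α (just 0 ∷ β) tail) ⟨
    drop (suc (length α)) (take (length (α ++ just 0 ∷ β)) ((α ++ just 0 ∷ β) ++ tail))
      ≡⟨ cong (drop (suc (length α))) (take-length-++ (α ++ just 0 ∷ β) tail) ⟩
    drop (suc (length α)) (α ++ just 0 ∷ β)
      ≡⟨ drop-suc-length-++ α (just 0) β ⟩
    β ∎
    where open ≡-Reasoning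

readTriple-shape : ∀ e h p g j → h ≡ 0 ⊎ g ≡ 0 →
  readTriple (e + h + p) (g + j) (bracket ⟦ e + h + p , g + j , 0 ⟧ ⟦ p , h + j , e + g ⟧) ≡ (p , e , g)
readTriple-shape e h p g j h0⊎g0 = begin
  readTriple (e + h + p) (g + j) (bracket ⟦ e + h + p , g + j , 0 ⟧ ⟦ p , h + j , e + g ⟧)
    ≡⟨ cong (readTriple (e + h + p) (g + j)) (bracket-shape e h p g j h0⊎g0) ⟩
  readTriple (e + h + p) (g + j) (α ++ just 0 ∷ β ++ just 1 ∷ just 2 ∷ [])
    ≡⟨ cong₂ (λ m k → readTriple m k (α ++ just 0 ∷ β ++ just 1 ∷ just 2 ∷ [])) lengthα lengthβ ⟨
  readTriple (length α) (length β) (α ++ just 0 ∷ β ++ just 1 ∷ just 2 ∷ [])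
    ≡⟨ readTriple-split α β ⟩
  (countJust 0 α + countJust 0 β , countJust 2 α , countJust 2 β)
    ≡⟨ cong₂ _,_ (cong₂ _+_ zerosα zerosβ) (cong₂ _,_ twosα twosβ) ⟩
  (p + 0 , e , g)
    ≡⟨ cong (_, e , g) (+-identityʳ p) ⟩
  (p , e , g) ∎
  where
  open ≡-Reasoning
  α β : List (Maybe ℕ)
  α = (block 2 e ++ block 1 h) ++ block 0 p
  β = block 2 g ++ block 1 j

  lengthα : length α ≡ e + h + p
  lengthα = length-replicate₃ e h p (just 2) (just 1) (just 0)
  lengthβ : length β ≡ g + j
  lengthβ = length-replicate₂ g j (just 2) (just 1)

  zerosα : countJust 0 α ≡ p
  zerosα rewrite countJust-++ 0 (block 2 e ++ block 1 h) (block 0 p) | countJust-++ 0 (block 2 e) (block 1 h)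
               | countJust-block-≢ 0 2 e (λ ()) | countJust-block-≢ 0 1 h (λ ()) | countJust-block 0 p = refl
  zerosβ : countJust 0 β ≡ 0
  zerosβ rewrite countJust-++ 0 (block 2 g) (block 1 j)
               | countJust-block-≢ 0 2 g (λ ()) | countJust-block-≢ 0 1 j (λ ()) = refl
  twosα : countJust 2 α ≡ e
  twosα rewrite countJust-++ 2 (block 2 e ++ block 1 h) (block 0 p) | countJust-++ 2 (block 2 e) (block 1 h)
              | countJust-block 2 e | countJust-block-≢ 2 1 h (λ ()) | countJust-block-≢ 2 0 p (λ ())
              | +-identityʳ e | +-identityʳ e = refl
  twosβ : countJust 2 β ≡ g
  twosβ rewrite countJust-++ 2 (block 2 g) (block 1 j)
              | countJust-block 2 g | countJust-block-≢ 2 1 j (λ ()) = +-identityʳ g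

cancel-parameters : ∀ {m k p q r} e h g j → m + k ≡ p + (q + r) →
  k ≡ g + j → q ≡ h + j → r ≡ e + g → m ≡ e + h + p
cancel-parameters {m} {p = p} e h g j total refl refl refl =
  +-cancelʳ-≡ (g + j) m (e + h + p) (trans total (arith p e h g j))
  where
  arith : ∀ p e h g j → p + ((h + j) + (e + g)) ≡ e + h + p + (g + j)
  arith = solve-∀

bracket-parameters : ∀ m k p q r → m + k ≡ p + (q + r) → k ≤ q + r →
  Σ[ e ∈ ℕ ] Σ[ h ∈ ℕ ] Σ[ g ∈ ℕ ] Σ[ j ∈ ℕ ]
    (h ≡ 0 ⊎ g ≡ 0) × m ≡ e + h + p × k ≡ g + j × q ≡ h + j × r ≡ e + g
bracket-parameters m k p q r total k≤q+r with ≤-total q k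
... | inj₁ q≤k = e , 0 , g , q , inj₁ refl , cancel-parameters e 0 g q total k≡ refl r≡ , k≡ , refl , r≡
  where
  g e : ℕ
  g = k ∸ q
  e = r ∸ g
  k≡ : k ≡ g + q
  k≡ = sym (m∸n+n≡m q≤k)
  r≡ : r ≡ e + g
  r≡ = sym (m∸n+n≡m (m≤n+o⇒m∸n≤o k q k≤q+r))
... | inj₂ k≤q = r , q ∸ k , 0 , k , inj₂ refl , cancel-parameters r (q ∸ k) 0 k total refl q≡ r≡ , refl , q≡ , r≡
  where
  q≡ : q ≡ q ∸ k + k
  q≡ = sym (m∸n+n≡m k≤q)
  r≡ : r ≡ r + 0
  r≡ = sym (+-identityʳ r)

readTriple-⟦⟧ : ∀ m k p q r → m + k ≡ p + (q + r) → k ≤ q + r →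
  readTriple m k (bracket ⟦ m , k , 0 ⟧ ⟦ p , q , r ⟧) ≡ (p , r ∸ (k ∸ q) , k ∸ q)
readTriple-⟦⟧ m k p q r total k≤q+r with bracket-parameters m k p q r total k≤q+r
... | e , h , g , j , h0⊎g0 , refl , refl , refl , refl = begin
  readTriple (e + h + p) (g + j) (bracket ⟦ e + h + p , g + j , 0 ⟧ ⟦ p , h + j , e + g ⟧)
    ≡⟨ readTriple-shape e h p g j h0⊎g0 ⟩
  (p , e , g)                      ≡⟨ cong (λ x → p , x , g) (m+n∸n≡m e g) ⟨
  (p , e + g ∸ g , g)              ≡⟨ cong (λ v → p , e + g ∸ v , v) ([h+j]∸[g+j]≡h g h j (swap h0⊎g0)) ⟨
  (p , e + g ∸ (g + j ∸ (h + j)) , g + j ∸ (h + j)) ∎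
  where open ≡-Reasoning

suvCoords : ℕ → Coords → ℕ × ℕ × ℕ
suvCoords k (p , q , r) = p , r ∸ (k ∸ q) , k ∸ q

suvOf-⟦⟧ : ∀ {a b k} c → k ≤ b → NuCoords a b c → suvOf a b k ⟦ c ⟧ ≡ suvCoords k c
suvOf-⟦⟧ {a} {b} {k} (p , q , r) k≤b (p≤a , total) =
  trans (suvOf-readTriple a b k ⟦ p , q , r ⟧)
        (readTriple-⟦⟧ (a + b ∸ k) k p q r total′ (k≤q+r p q r k≤b (p≤a , total)))
  where
  total′ : a + b ∸ k + k ≡ p + (q + r)
  total′ = trans (m∸n+n≡m (≤-trans k≤b (m≤n+m b a))) (sym total)

altChange-δk-suc : ∀ k i w → altChange (δk k) (suc i) w ≡ ℤ.- ℤ.+ countE w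
altChange-δk-suc k i       []      = refl
altChange-δk-suc k i       (E ∷ w) rewrite altChange-δk-suc k i w = step (countE w)
  where
  step : ∀ n → ℤ.-[1+ 0 ] ℤ.+ ℤ.- ℤ.+ n ≡ ℤ.- ℤ.+ suc n
  step zero    = refl
  step (suc n) = refl
altChange-δk-suc k zero    (N ∷ w) = trans (ℤₚ.+-identityˡ _) (altChange-δk-suc k 1 w)
altChange-δk-suc k (suc i) (N ∷ w) = trans (ℤₚ.+-identityˡ _) (altChange-δk-suc k (suc (suc i)) w)

returns-after-N⇔ : ∀ k w → altChange (δk k) 0 (N ∷ w) ≡ ℤ.+ 0 ⇔ countE w ≡ k
returns-after-N⇔ k w = mk⇔
  (λ ret → sym (ℤₚ.+-injective (ℤₚ.i-j≡0⇒i≡j (ℤ.+ k) (ℤ.+ countE w) (trans (sym alt) ret))))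
  (λ { refl → trans alt (ℤₚ.+-inverseʳ (ℤ.+ k)) })
  where
  alt : altChange (δk k) 0 (N ∷ w) ≡ ℤ.+ k ℤ.- ℤ.+ countE w
  alt = cong (ℤ._+_ (ℤ.+ k)) (altChange-δk-suc k 0 w)

FirstReturn : List ℕ → ℕ → Path → Set
FirstReturn δ i S = altChange δ i S ≡ ℤ.+ 0 × (∀ j → 0 < j → j < length S → altChange δ i (take j S) ≢ ℤ.+ 0)

rotation : ∀ {δ μ μ′} P S T → μ ≡ P ++ E ∷ N ∷ S ++ T → μ′ ≡ P ++ N ∷ S ++ E ∷ T →
           FirstReturn δ (countN P) (N ∷ S) → Rotation δ μ μ′
rotation P S T μ≡ μ′≡ (ret , first) = P , S ++ T , N ∷ S , T , μ≡ , refl , s≤s z≤n , ret , first , μ′≡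

firstReturn-N : ∀ k w → countE w ≡ k → (∀ t → t < length w → countE (take t w) < k) → FirstReturn (δk k) 0 (N ∷ w)
firstReturn-N k w total early =
  Equivalence.from (returns-after-N⇔ k w) total ,
  λ { (suc t) _ (s≤s t<) ret → <⇒≢ (early t t<) (Equivalence.to (returns-after-N⇔ k (take t w)) ret) }

countE-take≤ : ∀ t w → countE (take t w) ≤ t
countE-take≤ zero    w       = z≤n
countE-take≤ (suc t) []      = z≤n
countE-take≤ (suc t) (E ∷ w) = s≤s (countE-take≤ t w)
countE-take≤ (suc t) (N ∷ w) = m≤n⇒m≤1+n (countE-take≤ t w)

countE-take-∷ʳE : ∀ xs t → t < length (xs ∷ʳ E) → countE (take t (xs ∷ʳ E)) ≤ countE xs
countE-take-∷ʳE []       zero    _        = z≤n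
countE-take-∷ʳE []       (suc t) (s≤s ())
countE-take-∷ʳE (x ∷ xs) zero    _        = z≤n
countE-take-∷ʳE (E ∷ xs) (suc t) (s≤s t<) = s≤s (countE-take-∷ʳE xs t t<)
countE-take-∷ʳE (N ∷ xs) (suc t) (s≤s t<) = countE-take-∷ʳE xs t t<

<-length-Es-++ : ∀ q x w → q < length (Es q ++ x ∷ w)
<-length-Es-++ zero    x w = s≤s z≤n
<-length-Es-++ (suc q) x w = s≤s (<-length-Es-++ q x w)

countE-take-Es-++ : ∀ {k q} w → k ≤ q → countE (take k (Es q ++ w)) ≡ k
countE-take-Es-++         w z≤n       = refl
countE-take-Es-++ {suc k} w (s≤s k≤q) = cong suc (countE-take-Es-++ w k≤q)

-- The δ(k)-rotations in coordinates.  At the valley before the second N the subpath is that N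
-- alone (δ₂ = 0).  At the valley before the first N the subpath climbs k and returns to its
-- altitude after k east steps: within the middle run if k ≤ q, otherwise after the second N.
data Move (k : ℕ) : Coords → Coords → Set where
  second      : ∀ {p q r} → Move k (p , suc q , r) (p , q , suc r)
  first-short : ∀ {p q r} → k ≤ q → Move k (suc p , q , r) (p , suc q , r)
  first-long  : ∀ {p q r} → q < k → Move k (suc p , q , r) (p , q , suc r)

move-NuCoords : ∀ {a b k c c′} → Move k c c′ → NuCoords a b c → NuCoords a b c′
move-NuCoords {c = p , suc q , r} second          (p≤a , total) = p≤a , trans (cong (p +_) (+-suc q r)) total
move-NuCoords {c = suc p , q , r} (first-short _) (p<a , total) = <⇒≤ p<a , trans (+-suc p (q + r)) total
move-NuCoords {c = suc p , q , r} (first-long _)  (p<a , total) =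
  <⇒≤ p<a , trans (cong (p +_) (+-suc q r)) (trans (+-suc p (q + r)) total)

second-rotation : ∀ k p q r → Rotation (δk k) ⟦ p , suc q , r ⟧ ⟦ p , q , suc r ⟧
second-rotation k p q r =
  rotation (Es p ++ N ∷ Es q) [] (Es r)
    (sym (trans (++-assoc (Es p) (N ∷ Es q) (E ∷ N ∷ Es r))
                (cong (λ w → Es p ++ N ∷ w) (replicate-++-∷ q E (N ∷ Es r)))))
    (sym (++-assoc (Es p) (N ∷ Es q) (N ∷ E ∷ Es r)))
    (subst (λ i → FirstReturn (δk k) i (N ∷ [])) (sym one-N) (refl , λ { (suc j) _ (s≤s ()) }))
  where
  one-N : countN (Es p ++ N ∷ Es q) ≡ 1
  one-N rewrite countN-++ (Es p) (N ∷ Es q) | countN-Es p | countN-Es q = refl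

first-short-rotation : ∀ k p t r → Rotation (δk k) ⟦ suc p , k + t , r ⟧ ⟦ p , suc (k + t) , r ⟧
first-short-rotation k p t r =
  rotation (Es p) (Es k) (Es t ++ N ∷ Es r)
    (trans (cong (E ∷_) (cong (λ w → Es p ++ N ∷ w) middle)) (sym (replicate-++-∷ p E _)))
    (cong (λ w → Es p ++ N ∷ w) (trans (cong (E ∷_) middle) (sym (replicate-++-∷ k E _))))
    (subst (λ i → FirstReturn (δk k) i (N ∷ Es k)) (sym (countN-Es p))
       (firstReturn-N k (Es k) (countE-Es k)
          (λ i i< → ≤-<-trans (countE-take≤ i (Es k)) (subst (i <_) (length-replicate k) i<))))
  where
  middle : Es (k + t) ++ N ∷ Es r ≡ Es k ++ Es t ++ N ∷ Es r
  middle = trans (cong (_++ N ∷ Es r) (replicate-+ k t E)) (++-assoc (Es k) (Es t) (N ∷ Es r))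

first-long-rotation : ∀ p q t r′ → Rotation (δk (suc q + t)) ⟦ suc p , q , suc t + r′ ⟧ ⟦ p , q , suc (suc t + r′) ⟧
first-long-rotation p q t r′ =
  rotation (Es p) S (Es r′)
    (trans (cong (λ w → E ∷ Es p ++ N ∷ Es q ++ N ∷ E ∷ w) (replicate-+ t r′ E))
           (trans (cong (λ w → E ∷ Es p ++ N ∷ w) (sym (S++ (Es r′)))) (sym (replicate-++-∷ p E _))))
    (cong (λ w → Es p ++ N ∷ w)
          (sym (trans (S++ (E ∷ Es r′)) (cong (λ w → Es q ++ N ∷ E ∷ w)
                 (trans (replicate-++-∷ t E (Es r′)) (cong (E ∷_) (sym (replicate-+ t r′ E))))))))
    (subst (λ i → FirstReturn (δk (suc q + t)) i (N ∷ S)) (sym (countN-Es p))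
       (firstReturn-N (suc q + t) S countE-S
          (λ i i< → s≤s (subst (countE (take i S) ≤_) countE-middle (countE-take-∷ʳE _ i i<)))))
  where
  S : Path
  S = (Es q ++ N ∷ Es t) ∷ʳ E
  countE-middle : countE (Es q ++ N ∷ Es t) ≡ q + t
  countE-middle = trans (countE-++ (Es q) (N ∷ Es t)) (cong₂ _+_ (countE-Es q) (countE-Es t))
  countE-S : countE S ≡ suc (q + t)
  countE-S = trans (countE-++ (Es q ++ N ∷ Es t) (E ∷ [])) (trans (cong (_+ 1) countE-middle) (+-comm (q + t) 1))
  S++ : ∀ w → S ++ w ≡ Es q ++ N ∷ E ∷ Es t ++ w
  S++ w = trans (++-assoc (Es q ++ N ∷ Es t) (E ∷ []) w)
                (trans (++-assoc (Es q) (N ∷ Es t) (E ∷ w))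
                       (cong (λ x → Es q ++ N ∷ x) (replicate-++-∷ t E w)))

move⇒rotation : ∀ {k p q r c′} → k ≤ q + r → Move k (p , q , r) c′ → Rotation (δk k) ⟦ p , q , r ⟧ ⟦ c′ ⟧
move⇒rotation {k} {p} {suc q} {r} _ second = second-rotation k p q r
move⇒rotation {k} {suc p} {q} {r} _ (first-short k≤q) with m≤n⇒∃[o]m+o≡n k≤q
... | t , refl = first-short-rotation k p t r
move⇒rotation {k} {suc p} {q} {r} k≤q+r (first-long q<k) with m≤n⇒∃[o]m+o≡n q<k
... | t , refl with m≤n⇒∃[o]m+o≡n (+-cancelˡ-≤ q (suc t) r (subst (_≤ q + r) (sym (+-suc q t)) k≤q+r))
... | r′ , refl = first-long-rotation p q t r′

move⇒cover : ∀ {a b k c c′} → k ≤ b → NuCoords a b c → Move k c c′ → Cover (νab a b) (δk k) ⟦ c ⟧ ⟦ c′ ⟧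
move⇒cover {c = p , q , r} k≤b ok m =
  NuCoords⇒IsNuPath _ ok , NuCoords⇒IsNuPath _ (move-NuCoords m ok) ,
  move⇒rotation (k≤q+r p q r k≤b ok) m

rotated-head : ∀ {R} S T → N ∷ R ≡ S ++ T → 0 < length S → Σ[ S′ ∈ Path ] S ≡ N ∷ S′ × R ≡ S′ ++ T
rotated-head (x ∷ S′) T eq _ with ∷-injective eq
... | refl , R≡ = S′ , refl , R≡

valley-split : ∀ p w P R → Es p ++ N ∷ w ≡ P ++ E ∷ N ∷ R →
    (Σ[ p′ ∈ ℕ ] p ≡ suc p′ × P ≡ Es p′ × R ≡ w)
  ⊎ (Σ[ P′ ∈ Path ] P ≡ Es p ++ N ∷ P′ × w ≡ P′ ++ E ∷ N ∷ R)
valley-split zero          w (N ∷ P′) R eq   = inj₂ (P′ , refl , proj₂ (∷-injective eq))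
valley-split (suc zero)    w []       R refl = inj₁ (0 , refl , refl , refl)
valley-split (suc p)       w (E ∷ P′) R eq   with valley-split p w P′ R (proj₂ (∷-injective eq))
... | inj₁ (p′ , refl , refl , refl) = inj₁ (suc p′ , refl , refl , refl)
... | inj₂ (P″ , refl , w≡)         = inj₂ (P″ , refl , w≡)
valley-split zero          w []       R ()
valley-split zero          w (E ∷ P′) R ()
valley-split (suc (suc p)) w []       R ()
valley-split (suc p)       w (N ∷ P′) R ()

Es-no-valley : ∀ r P R → Es r ≢ P ++ E ∷ N ∷ R
Es-no-valley (suc r) (E ∷ P) R eq = Es-no-valley r P R (proj₂ (∷-injective eq))
Es-no-valley (suc zero)    [] R ()
Es-no-valley (suc (suc r)) [] R ()
Es-no-valley (suc r) (N ∷ P) R ()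

split-Es-++-N : ∀ q S T w → S ++ T ≡ Es q ++ N ∷ w →
  (Σ[ j ∈ ℕ ] j ≤ q × S ≡ Es j) ⊎ (Σ[ S′ ∈ Path ] S ≡ Es q ++ N ∷ S′ × S′ ++ T ≡ w)
split-Es-++-N q       []      T w eq = inj₁ (0 , z≤n , refl)
split-Es-++-N zero    (N ∷ S) T w eq = inj₂ (S , refl , proj₂ (∷-injective eq))
split-Es-++-N (suc q) (E ∷ S) T w eq with split-Es-++-N q S T w (proj₂ (∷-injective eq))
... | inj₁ (j , j≤q , refl)    = inj₁ (suc j , s≤s j≤q , refl)
... | inj₂ (S′ , refl , S′++T) = inj₂ (S′ , refl , S′++T)
split-Es-++-N zero    (E ∷ S) T w ()
split-Es-++-N (suc q) (N ∷ S) T w ()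

insert-E : ∀ r S T → S ++ T ≡ Es r → S ++ E ∷ T ≡ E ∷ Es r
insert-E r       []      T eq = cong (E ∷_) eq
insert-E (suc r) (E ∷ S) T eq = cong (E ∷_) (insert-E r S T (proj₂ (∷-injective eq)))
insert-E zero    (x ∷ S) T ()
insert-E (suc r) (N ∷ S) T ()

rotation-at-first : ∀ {k p q r S T} → S ++ T ≡ Es q ++ N ∷ Es r → FirstReturn (δk k) 0 (N ∷ S) →
  Σ[ c′ ∈ Coords ] Move k (suc p , q , r) c′ × Es p ++ N ∷ S ++ E ∷ T ≡ ⟦ c′ ⟧
rotation-at-first {k} {p} {q} {r} {S} {T} S++T (ret , first) with split-Es-++-N q S T (Es r) S++T
... | inj₁ (j , j≤q , refl) =
  (p , suc q , r) , first-short (subst (_≤ q) j≡k j≤q) ,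
  cong (λ w → Es p ++ N ∷ w) (trans (replicate-++-∷ j E T) (cong (E ∷_) S++T))
  where
  j≡k : j ≡ k
  j≡k = trans (sym (countE-Es j)) (Equivalence.to (returns-after-N⇔ k (Es j)) ret)
... | inj₂ (S′ , refl , S′++T) =
  (p , q , suc r) , first-long (≰⇒> k≰q) ,
  cong (λ w → Es p ++ N ∷ w) (trans (++-assoc (Es q) (N ∷ S′) (E ∷ T))
                                    (cong (λ w → Es q ++ N ∷ w) (insert-E r S′ T S′++T)))
  where
  -- If k ≤ q, the proper prefix N E^k of N ∷ S already returns to altitude 0.
  k≰q : k ≰ q
  k≰q k≤q = first (suc k) (s≤s z≤n) (s≤s (≤-<-trans k≤q (<-length-Es-++ q N S′)))
                  (Equivalence.from (returns-after-N⇔ k (take k (Es q ++ N ∷ S′))) (countE-take-Es-++ (N ∷ S′) k≤q))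

rotation⇒move : ∀ {k p q r μ′} → Rotation (δk k) ⟦ p , q , r ⟧ μ′ →
  Σ[ c′ ∈ Coords ] Move k (p , q , r) c′ × μ′ ≡ ⟦ c′ ⟧
rotation⇒move {k} {p} {q} {r} (P , R , S , T , μ≡ , NR≡ , 0<S , ret , first , refl)
  with rotated-head S T NR≡ 0<S
... | S′ , refl , R≡ with valley-split p (Es q ++ N ∷ Es r) P R μ≡
... | inj₁ (p′ , refl , refl , refl) =
  rotation-at-first (sym R≡) (subst (λ i → FirstReturn (δk k) i (N ∷ S′)) (countN-Es p′) (ret , first))
... | inj₂ (P′ , refl , w≡) with valley-split q (Es r) P′ R w≡
...   | inj₁ (q′ , refl , refl , refl) =
  (p , q′ , suc r) , second ,
  trans (++-assoc (Es p) (N ∷ Es q′) (N ∷ S′ ++ E ∷ T))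
        (cong (λ w → Es p ++ N ∷ Es q′ ++ N ∷ w) (insert-E r S′ T (sym R≡)))
...   | inj₂ (_ , _ , Es≡) = ⊥-elim (Es-no-valley r _ R Es≡)

infix 4 _⊑_
_⊑_ : ℕ × ℕ × ℕ → ℕ × ℕ × ℕ → Set
(s₁ , u₁ , v₁) ⊑ (s₂ , u₂ , v₂) = s₁ ≥ s₂ × u₁ ≤ u₂ × v₁ ≤ v₂

⊑-refl : ∀ {t} → t ⊑ t
⊑-refl = ≤-refl , ≤-refl , ≤-refl

⊑-trans : ∀ {t₁ t₂ t₃} → t₁ ⊑ t₂ → t₂ ⊑ t₃ → t₁ ⊑ t₃
⊑-trans (s₂≤s₁ , u₁≤u₂ , v₁≤v₂) (s₃≤s₂ , u₂≤u₃ , v₂≤v₃) =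
  ≤-trans s₃≤s₂ s₂≤s₁ , ≤-trans u₁≤u₂ u₂≤u₃ , ≤-trans v₁≤v₂ v₂≤v₃

move-⊑ : ∀ {k c c′} → Move k c c′ → suvCoords k c ⊑ suvCoords k c′
move-⊑ {k} {p , suc q , r} second =
  ≤-refl , ∸-monoʳ-≤ (suc r) (∸-suc-≤ k q) , ∸-monoʳ-≤ k (n≤1+n q)
move-⊑ {k} {suc p , q , r} (first-short k≤q) =
  n≤1+n p , ≤-reflexive (cong (r ∸_) both-zero) , ≤-reflexive both-zero
  where
  both-zero : k ∸ q ≡ k ∸ suc q
  both-zero = trans (m≤n⇒m∸n≡0 k≤q) (sym (m≤n⇒m∸n≡0 (m≤n⇒m≤1+n k≤q)))
move-⊑ {k} {suc p , q , r} (first-long _) =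
  n≤1+n p , ∸-monoˡ-≤ (k ∸ q) (n≤1+n r) , ≤-refl

cover-⊑ : ∀ {a b k μ μ′} → k ≤ b → Cover (νab a b) (δk k) μ μ′ → suvOf a b k μ ⊑ suvOf a b k μ′
cover-⊑ k≤b (ν , _ , rot) with IsNuPath⇒NuCoords ν
... | c , refl , ok with rotation⇒move rot
... | c′ , m , refl =
  subst₂ _⊑_ (sym (suvOf-⟦⟧ c k≤b ok)) (sym (suvOf-⟦⟧ c′ k≤b (move-NuCoords m ok))) (move-⊑ m)

TamLeq⇒⊑ : ∀ {a b k μ μ′} → k ≤ b → TamLeq a b k μ μ′ → suvOf a b k μ ⊑ suvOf a b k μ′
TamLeq⇒⊑ k≤b ε        = ⊑-refl
TamLeq⇒⊑ k≤b (c ◅ cs) = ⊑-trans (cover-⊑ k≤b c) (TamLeq⇒⊑ k≤b cs)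

moves⇒TamLeq : ∀ {a b k c c′} → k ≤ b → NuCoords a b c → Star (Move k) c c′ → TamLeq a b k ⟦ c ⟧ ⟦ c′ ⟧
moves⇒TamLeq k≤b ok ε        = ε
moves⇒TamLeq k≤b ok (m ◅ ms) = move⇒cover k≤b ok m ◅ moves⇒TamLeq k≤b (move-NuCoords m ok) ms

second-moves : ∀ {k} p q r d → Star (Move k) (p , d + q , r) (p , q , d + r)
second-moves     p q r zero    = ε
second-moves {k} p q r (suc d) =
  second ◅ subst (λ r′ → Star (Move k) (p , d + q , suc r) (p , q , r′)) (+-suc d r) (second-moves p q (suc r) d)

u+v≡r : ∀ {k q r} → k ≤ q + r → r ∸ (k ∸ q) + (k ∸ q) ≡ r
u+v≡r {k} {q} k≤q+r = m∸n+n≡m (m≤n+o⇒m∸n≤o k q k≤q+r)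

u+k≡q+r : ∀ {k q r} → q ≤ k → k ≤ q + r → r ∸ (k ∸ q) + k ≡ q + r
u+k≡q+r {k} {q} {r} q≤k k≤q+r = begin
  r ∸ (k ∸ q) + k                 ≡⟨ cong (r ∸ (k ∸ q) +_) (m∸n+n≡m q≤k) ⟨
  r ∸ (k ∸ q) + (k ∸ q + q)       ≡⟨ +-assoc (r ∸ (k ∸ q)) (k ∸ q) q ⟨
  r ∸ (k ∸ q) + (k ∸ q) + q       ≡⟨ cong (_+ q) (u+v≡r k≤q+r) ⟩
  r + q                           ≡⟨ +-comm r q ⟩
  q + r                           ∎
  where open ≡-Reasoning

⊑⇒moves-same-p : ∀ {k} p q₁ r₁ q₂ r₂ → q₁ + r₁ ≡ q₂ + r₂ → k ≤ q₁ + r₁ → k ≤ q₂ + r₂ →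
  r₁ ∸ (k ∸ q₁) ≤ r₂ ∸ (k ∸ q₂) → k ∸ q₁ ≤ k ∸ q₂ → Star (Move k) (p , q₁ , r₁) (p , q₂ , r₂)
⊑⇒moves-same-p {k} p q₁ r₁ q₂ r₂ same-sum k≤₁ k≤₂ u≤ v≤ with m≤n⇒∃[o]m+o≡n r₁≤r₂
  where
  r₁≤r₂ : r₁ ≤ r₂
  r₁≤r₂ = subst₂ _≤_ (u+v≡r k≤₁) (u+v≡r k≤₂) (+-mono-≤ u≤ v≤)
... | d , refl =
  subst₂ (λ q r → Star (Move k) (p , q , r₁) (p , q₂ , r)) q₁≡ (+-comm d r₁) (second-moves p q₂ r₁ d)
  where
  q₁≡ : d + q₂ ≡ q₁
  q₁≡ = +-cancelʳ-≡ r₁ (d + q₂) q₁ (trans (arith d q₂ r₁) (sym same-sum))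
    where
    arith : ∀ d q r → d + q + r ≡ q + (r + d)
    arith = solve-∀

u-after-first-long : ∀ {k q₁ r₁ q₂ r₂} → q₁ < k → k ≤ q₁ + suc r₁ → k ≤ q₂ + r₂ →
  k ∸ q₁ ≤ k ∸ q₂ → q₁ + suc r₁ ≤ q₂ + r₂ → suc r₁ ∸ (k ∸ q₁) ≤ r₂ ∸ (k ∸ q₂)
u-after-first-long {k} {q₁} {r₁} {q₂} {r₂} q₁<k k≤₁ k≤₂ v≤ sum≤ =
  +-cancelʳ-≤ k _ _ (subst₂ _≤_ (sym (u+k≡q+r (<⇒≤ q₁<k) k≤₁)) (sym (u+k≡q+r q₂≤k k≤₂)) sum≤)
  where
  -- k ∸ q₂ ≥ k ∸ q₁ > 0
  q₂≤k : q₂ ≤ k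
  q₂≤k = ≮⇒≥ λ k<q₂ →
    <⇒≱ q₁<k (m∸n≡0⇒m≤n (n≤0⇒n≡0 (subst (k ∸ q₁ ≤_) (m≤n⇒m∸n≡0 (<⇒≤ k<q₂)) v≤)))

⊑⇒moves : ∀ {a b k} → k ≤ b → ∀ p₁ q₁ r₁ p₂ q₂ r₂ → NuCoords a b (p₁ , q₁ , r₁) → NuCoords a b (p₂ , q₂ , r₂) →
  suvCoords k (p₁ , q₁ , r₁) ⊑ suvCoords k (p₂ , q₂ , r₂) → Star (Move k) (p₁ , q₁ , r₁) (p₂ , q₂ , r₂)
⊑⇒moves {k = k} k≤b p₁ q₁ r₁ p₂ q₂ r₂ ok₁ ok₂ (p₂≤p₁ , u≤ , v≤) with m≤n⇒m<n∨m≡n p₂≤p₁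
... | inj₂ refl =
  ⊑⇒moves-same-p p₁ q₁ r₁ q₂ r₂ (+-cancelˡ-≡ p₁ _ _ (trans (proj₂ ok₁) (sym (proj₂ ok₂))))
                 (k≤q+r p₁ q₁ r₁ k≤b ok₁) (k≤q+r p₂ q₂ r₂ k≤b ok₂) u≤ v≤
⊑⇒moves {a} {b} {k} k≤b (suc p) q₁ r₁ p₂ q₂ r₂ ok₁ ok₂ (_ , u≤ , v≤) | inj₁ (s≤s p₂≤p) with k ≤? q₁
... | yes k≤q₁ =
  first-short k≤q₁ ◅ ⊑⇒moves k≤b p (suc q₁) r₁ p₂ q₂ r₂ (move-NuCoords (first-short k≤q₁) ok₁) ok₂ (p₂≤p , u≤′ , v≤′)
  where
  both-zero : k ∸ suc q₁ ≡ k ∸ q₁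
  both-zero = trans (m≤n⇒m∸n≡0 (m≤n⇒m≤1+n k≤q₁)) (sym (m≤n⇒m∸n≡0 k≤q₁))
  u≤′ : r₁ ∸ (k ∸ suc q₁) ≤ r₂ ∸ (k ∸ q₂)
  u≤′ = subst (λ v → r₁ ∸ v ≤ r₂ ∸ (k ∸ q₂)) (sym both-zero) u≤
  v≤′ : k ∸ suc q₁ ≤ k ∸ q₂
  v≤′ = subst (_≤ k ∸ q₂) (sym both-zero) v≤
... | no k≰q₁ =
  first-long q₁<k ◅ ⊑⇒moves k≤b p q₁ (suc r₁) p₂ q₂ r₂ ok₁′ ok₂ (p₂≤p , u≤′ , v≤)
  where
  q₁<k : q₁ < k
  q₁<k = ≰⇒> k≰q₁
  ok₁′ : NuCoords a b (p , q₁ , suc r₁)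
  ok₁′ = move-NuCoords (first-long q₁<k) ok₁
  sum≤ : q₁ + suc r₁ ≤ q₂ + r₂
  sum≤ = +-cancelˡ-≤ p₂ _ _ (subst (p₂ + (q₁ + suc r₁) ≤_) (trans (proj₂ ok₁′) (sym (proj₂ ok₂)))
                                    (+-monoˡ-≤ (q₁ + suc r₁) p₂≤p))
  u≤′ : suc r₁ ∸ (k ∸ q₁) ≤ r₂ ∸ (k ∸ q₂)
  u≤′ = u-after-first-long {q₂ = q₂} {r₂} q₁<k (k≤q+r p q₁ (suc r₁) k≤b ok₁′) (k≤q+r p₂ q₂ r₂ k≤b ok₂) v≤ sum≤

lemma4p3 : (a b k : ℕ) → k ≤ b → (μ₁ μ₂ : Path) →
    IsNuPath (νab a b) μ₁ → IsNuPath (νab a b) μ₂ →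
    TamLeq a b k μ₁ μ₂ ⇔
      ((sOf a b k μ₁ ≥ sOf a b k μ₂) × (uOf a b k μ₁ ≤ uOf a b k μ₂)
        × (vOf a b k μ₁ ≤ vOf a b k μ₂))
lemma4p3 a b k k≤b μ₁ μ₂ ν₁ ν₂ with IsNuPath⇒NuCoords ν₁ | IsNuPath⇒NuCoords ν₂
... | c₁@(p₁ , q₁ , r₁) , refl , ok₁ | c₂@(p₂ , q₂ , r₂) , refl , ok₂ =
  mk⇔ (TamLeq⇒⊑ k≤b)
      (λ suv≤ → moves⇒TamLeq k≤b ok₁
                  (⊑⇒moves k≤b p₁ q₁ r₁ p₂ q₂ r₂ ok₁ ok₂
                     (subst₂ _⊑_ (suvOf-⟦⟧ c₁ k≤b ok₁) (suvOf-⟦⟧ c₂ k≤b ok₂) suv≤)))
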